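{- Let $D\ge 2$ be squarefree, $K=\mathbb{Q}(\sqrt D)$, and let $\omega_D = [\lceil u_0/2\rceil; \overline{u_1,\dots,u_s}]$ be the continued fraction expansion of $\omega_D$ (with $u_s=u_0$). If $B := \max\{u_i \,:\, i \geq 1 \text{ odd}\}$, then \[ S := \left\{1,2,\dots,\left\lfloor \tfrac{B}{2}\right\rfloor + 2\right\} \subset p_K(\mathcal{O}_K^+), \] i.e. for every $m \in S$ there exists $\alpha \in \mathcal{O}_K^+$ with exactly $m$ partitions.
   Context: $\omega_D=\sqrt D$ if $D\equiv 2,3\pmod 4$ and $\omega_D=(1+\sqrt D)/2$ if $D\equiv1\pmod 4$. Its continued fraction is eventually periodic of the form $[\lceil u_0/2\rceil;\overline{u_1,\dots,u_s}]$ with $u_s=u_0$, and the $u_i$ are extended periodically to all $i\ge 1$. $\mathcal{O}_K^+$ is the set of totally positive algebraic integers of $K$ (both real embeddings positive). A partition of $\alpha\in\mathcal{O}_K^+$ is a representation $\alpha=\lambda_1+\dots+\lambda_\ell$ with $\ell\ge1$ and all $\lambda_i\in\mathcal{O}_K^+$, unordered (representations differing only by order of summands are the same); $p_K(\alpha)$ is the number of partitions of $\alpha$, and $p_K(\mathcal{O}_K^+)$ is the set of values $p_K(\alpha)$, $\alpha\in\mathcal{O}_K^+$. -}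

module Defs where

open import Data.Nat as ℕ using (ℕ; zero; suc)
open import Data.Nat.Divisibility as ℕD using ()
open import Data.Nat.DivMod using (_%_)
open import Data.Nat.Properties using (_≟_)
open import Data.Integer as ℤ using (ℤ; +_; +0)
open import Data.Fin using (Fin)
open import Data.List using (List; []; _∷_; foldr)
open import Data.List.Relation.Unary.All using (All)
open import Data.List.Relation.Binary.Permutation.Propositional using (_↭_)
open import Data.Product using (Σ; ∃; _×_; _,_)
open import Data.Sum using (_⊎_)
open import Relation.Binary.PropositionalEquality using (_≡_; _≢_)
open import Relation.Nullary using (¬_; yes; no)

Squarefree : ℕ → Set
Squarefree D = ∀ (k : ℕ) → (k ℕ.* k) ℕD.∣ D → k ≡ 1

Dz : ℕ → ℤ
Dz D = + D

isOneMod4 : ℕ → Set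
isOneMod4 D = D % 4 ≡ 1

_≤√_ : ℤ → ℕ → Set
c ≤√ D = (c ℤ.≤ +0) ⊎ (c ℤ.* c ℤ.≤ + D)

_<√_ : ℤ → ℕ → Set
c <√ D = (c ℤ.< +0) ⊎ (c ℤ.* c ℤ.< + D)

-- x + y√D > 0   (x, y integers)
PosSurd : ℕ → ℤ → ℤ → Set
PosSurd D x y =
    (+0 ℤ.< x × (+0 ℤ.≤ y ⊎ y ℤ.* y ℤ.* + D ℤ.< x ℤ.* x))
  ⊎ (+0 ℤ.< y × (+0 ℤ.≤ x ⊎ x ℤ.* x ℤ.< y ℤ.* y ℤ.* + D))

-- The ring of integers O_K, K = Q(√D), with integral basis {1, ω_D}.
-- The pair (a , b) represents a + b ω_D.

OK : Set
OK = ℤ × ℤ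

_⊕_ : OK → OK → OK
(a , b) ⊕ (c , d) = (a ℤ.+ c , b ℤ.+ d)

zeroOK : OK
zeroOK = (+0 , +0)

sumOK : List OK → OK
sumOK = foldr _⊕_ zeroOK

-- Totally positive: both real embeddings positive.
--  D ≢ 1 (mod 4): ω = √D, embeddings a ± b√D.
--  D ≡ 1 (mod 4): ω = (1+√D)/2, embeddings ((2a+b) ± b√D)/2.
TotPos : ℕ → OK → Set
TotPos D (a , b) with D % 4 ≟ 1
... | yes _ = PosSurd D (ℤ.+ 2 ℤ.* a ℤ.+ b) b × PosSurd D (+ 2 ℤ.* a ℤ.+ b) (ℤ.- b)
... | no  _ = PosSurd D a b × PosSurd D a (ℤ.- b)

-- Partitions: a (nonempty) list of totally positive integers summing
-- to α; two lists are the same partition iff they are permutations of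
-- each other.

IsPartition : ℕ → OK → List OK → Set
IsPartition D α L = (L ≢ []) × All (TotPos D) L × sumOK L ≡ α

-- p_K(α) = m : there are exactly m partitions of α up to reordering,
-- witnessed by a list f of representatives meeting every class exactly once.
HasNumPartitions : ℕ → OK → ℕ → Set
HasNumPartitions D α m =
  Σ (Fin m → List OK) λ f →
      (∀ i → IsPartition D α (f i))
    × (∀ i j → f i ↭ f j → i ≡ j)
    × (∀ L → IsPartition D α L → ∃ λ i → L ↭ f i)

-- The complete quotients are x_n = (P n + √D) / Q n with Q n ≠ 0,
-- x_0 = ω_D, digit a n = ⌊x_n⌋ and x_{n+1} = 1/(x_n - a n), i.e.
--   P (n+1) = a n · Q n - P n,   Q (n+1) · Q n = D - P (n+1)².

-- k = ⌊(P + √D)/Q⌋  (Q ≠ 0)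
IsFloor : ℕ → ℤ → ℤ → ℤ → Set
IsFloor D k P Q =
    (+0 ℤ.< Q × (k ℤ.* Q ℤ.- P) ≤√ D × ¬ ((k ℤ.+ + 1) ℤ.* Q ℤ.- P) ≤√ D)
  ⊎ (Q ℤ.< +0 × ¬ (k ℤ.* Q ℤ.- P) <√ D × ((k ℤ.+ + 1) ℤ.* Q ℤ.- P) <√ D)

InitialPQ : ℕ → ℤ → ℤ → Set
InitialPQ D P0 Q0 with D % 4 ≟ 1
... | yes _ = P0 ≡ + 1 × Q0 ≡ + 2   -- ω_D = (1 + √D)/2
... | no  _ = P0 ≡ +0  × Q0 ≡ + 1   -- ω_D = (0 + √D)/1

-- a is the sequence of partial quotients of ω_D = [a 0; a 1, a 2, …]
-- (so a i = u_i for i ≥ 1 in the paper's notation).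
IsCFOmega : ℕ → (ℕ → ℕ) → Set
IsCFOmega D a =
  Σ (ℕ → ℤ) λ P → Σ (ℕ → ℤ) λ Q →
      InitialPQ D (P 0) (Q 0)
    × (∀ n → IsFloor D (+ a n) (P n) (Q n))
    × (∀ n → P (suc n) ≡ + a n ℤ.* Q n ℤ.- P n)
    × (∀ n → Q (suc n) ℤ.* Q n ≡ + D ℤ.- P (suc n) ℤ.* P (suc n))

Odd : ℕ → Set
Odd i = i % 2 ≡ 1

IsMaxOdd : (ℕ → ℕ) → ℕ → Set
IsMaxOdd a B = (∃ λ i → Odd i × a i ≡ B) × (∀ i → Odd i → a i ℕ.≤ B)

{-# OPTIONS --safe #-}
-- Fix an odd index i with uᵢ = B and let ξᵢ = (Pᵢ + √D)/Qᵢ be the complete quotient, which is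
-- reduced: ξᵢ > 1 and -1 < ξ̄ᵢ < 0.  Unwinding the expansion up to ξᵢ gives integral coordinates
-- γ ↦ (x , y) on O_K in which, as i is odd, γ is totally positive iff -xξᵢ < y < -xξ̄ᵢ.  Hence
-- totally positive elements have x ≥ 1, and those with x = 1 (the atoms) are exactly the ones with
-- -uᵢ ≤ y ≤ 0.  As x is additive, the element with coordinates (1 , 0) has one partition, and the
-- one with coordinates (2 , -2k), 2k ≤ B, has k + 2: itself and the sums of the atoms (1 , -j)
-- and (1 , j - 2k) for j = 0, …, k.
module Submission where

open import Defs

open import Data.Nat as ℕ using (ℕ; zero; suc; s≤s; z≤n; NonZero)
import Data.Nat.Properties as ℕₚ
open import Data.Nat.Divisibility using (_∣_; divides; ∣-refl; ∣-reflexive)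
open import Data.Nat.DivMod using (_/_; _%_; m/n*n≡m; m/n*n≤m)
open import Data.Nat.GCD using (gcd; gcd[m,n]∣m; gcd[m,n]∣n; gcd[m,n]≢0)
open import Data.Nat.Coprimality as Coprime using (Coprime; coprime-/gcd; coprime-divisor)
import Data.Nat.Tactic.RingSolver as ℕ-Solver
open import Data.Integer
  using ( ℤ; +_; +[1+_]; -[1+_]; 0ℤ; 1ℤ; -1ℤ; -_; _+_; _-_; _*_; _<_; _≤_; _<?_; _≤?_
        ; +<+; +≤+; ∣_∣; nonNegative)
open import Data.Integer.Properties
open import Data.Integer.Tactic.RingSolver using (solve-∀)
open import Data.Fin using (Fin; zero; suc; toℕ; fromℕ<)
open import Data.Fin.Properties using (toℕ-injective; toℕ-fromℕ<; toℕ≤pred[n])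
open import Data.List using (List; []; _∷_; length)
open import Data.List.Relation.Unary.All using (All; []; _∷_)
open import Data.List.Relation.Unary.Any using (here; there)
open import Data.List.Membership.Propositional using (_∈_)
open import Data.List.Relation.Binary.Permutation.Propositional using (_↭_; ↭-refl; ↭-reflexive; ↭-trans; swap)
open import Data.List.Relation.Binary.Permutation.Propositional.Properties using (∈-resp-↭; ↭-length)
open import Data.Product using (Σ; ∃; ∃₂; _×_; _,_; proj₁; proj₂)
open import Data.Product.Function.NonDependent.Propositional using (_×-⇔_)
open import Data.Sum using (_⊎_; inj₁; inj₂)
open import Data.Empty using (⊥-elim)
open import Relation.Nullary using (¬_; yes; no)
open import Relation.Binary.Definitions using (tri<; tri≈; tri>)
open import Relation.Binary.PropositionalEquality
open import Function using (_∘_; _⇔_; mk⇔; Equivalence)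
open import Function.Construct.Composition using (_⇔-∘_)

coprime⇒p²≢Dq² : ∀ {D p q} → 2 ℕ.≤ D → Squarefree D → Coprime p q → p ℕ.* p ≢ D ℕ.* (q ℕ.* q)
coprime⇒p²≢Dq² {D} {p} {q} D≥2 sf p⊥q eq = ℕₚ.<-irrefl (sym D≡1) D≥2
  where
  q∣p : q ∣ p
  q∣p = coprime-divisor (Coprime.sym p⊥q) (divides (D ℕ.* q) (trans eq (sym (ℕₚ.*-assoc D q q))))
  q≡1 : q ≡ 1
  q≡1 = p⊥q (q∣p , ∣-refl)
  p*p≡D : p ℕ.* p ≡ D
  p*p≡D = trans eq (trans (cong (λ t → D ℕ.* (t ℕ.* t)) q≡1) (ℕₚ.*-identityʳ D))
  D≡1 : D ≡ 1
  D≡1 = trans (sym p*p≡D) (cong (λ t → t ℕ.* t) (sf p (∣-reflexive p*p≡D)))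

p²≡Dq²-cancel-factor : ∀ D {p q} p′ q′ g .{{_ : NonZero g}} → p′ ℕ.* g ≡ p → q′ ℕ.* g ≡ q →
  p ℕ.* p ≡ D ℕ.* (q ℕ.* q) → p′ ℕ.* p′ ≡ D ℕ.* (q′ ℕ.* q′)
p²≡Dq²-cancel-factor D p′ q′ g refl refl eq =
  ℕₚ.*-cancelʳ-≡ (p′ ℕ.* p′) (D ℕ.* (q′ ℕ.* q′)) (g ℕ.* g) {{ℕₚ.m*n≢0 g g}}
    (trans (regroup p′ g) (trans eq (regroupD D q′ g)))
  where
  regroup : ∀ x g → (x ℕ.* x) ℕ.* (g ℕ.* g) ≡ (x ℕ.* g) ℕ.* (x ℕ.* g)
  regroup = ℕ-Solver.solve-∀
  regroupD : ∀ d x g → d ℕ.* ((x ℕ.* g) ℕ.* (x ℕ.* g)) ≡ (d ℕ.* (x ℕ.* x)) ℕ.* (g ℕ.* g)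
  regroupD = ℕ-Solver.solve-∀

sqrt-irrational : ∀ {D} → 2 ℕ.≤ D → Squarefree D → ∀ p q → p ℕ.* p ≡ D ℕ.* (q ℕ.* q) → q ≡ 0
sqrt-irrational D≥2 sf p zero eq = refl
sqrt-irrational {D} D≥2 sf p q@(suc _) eq =
  ⊥-elim (coprime⇒p²≢Dq² D≥2 sf (coprime-/gcd p q)
    (p²≡Dq²-cancel-factor D (p / gcd p q) (q / gcd p q) (gcd p q)
      (m/n*n≡m (gcd[m,n]∣m p q)) (m/n*n≡m (gcd[m,n]∣n p q)) eq))
  where instance
  gcd≢0 : NonZero (gcd p q)
  gcd≢0 = ℕ.≢-nonZero (gcd[m,n]≢0 p q (inj₂ λ ()))

i<j⇒0<j-i : ∀ {i j} → i < j → 0ℤ < j - i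
i<j⇒0<j-i {i} {j} i<j = subst (_< j - i) (+-inverseʳ i) (+-monoˡ-< (- i) i<j)

0<i-j⇒j<i : ∀ {i j} → 0ℤ < i - j → j < i
0<i-j⇒j<i {i} {j} 0<i-j = subst₂ _<_ (+-identityˡ j) (cancel i j) (+-monoˡ-< j 0<i-j)
  where
  cancel : ∀ i j → i - j + j ≡ i
  cancel = solve-∀

*-pos : ∀ {i j} → 0ℤ < i → 0ℤ < j → 0ℤ < i * j
*-pos {+[1+ m ]} {+[1+ n ]} _ _ = +<+ (s≤s z≤n)
*-pos {+ zero} (+<+ ()) _
*-pos {+[1+ m ]} {+ zero} _ (+<+ ())

*-nonNeg : ∀ {i j} → 0ℤ ≤ i → 0ℤ ≤ j → 0ℤ ≤ i * j
*-nonNeg {+ m} {+ n} _ _ = subst (0ℤ ≤_) (pos-* m n) (+≤+ z≤n)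

square-nonNeg : ∀ i → 0ℤ ≤ i * i
square-nonNeg (+ n) = *-nonNeg {+ n} {+ n} (+≤+ z≤n) (+≤+ z≤n)
square-nonNeg -[1+ n ] = +≤+ z≤n

*-mono-<-nonNeg : ∀ {i j k l} → 0ℤ ≤ i → i < j → 0ℤ ≤ k → k < l → i * k < j * l
*-mono-<-nonNeg {i} {j} {k} {l} 0≤i i<j 0≤k k<l =
  0<i-j⇒j<i (subst (0ℤ <_) (sym (split i j k l))
    (+-mono-<-≤ (*-pos (i<j⇒0<j-i i<j) (≤-<-trans 0≤k k<l)) (*-nonNeg 0≤i (<⇒≤ (i<j⇒0<j-i k<l)))))
  where
  split : ∀ i j k l → j * l - i * k ≡ (j - i) * l + i * (l - k)
  split = solve-∀

neg-square : ∀ i → - i * - i ≡ i * i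
neg-square = solve-∀

square-mono-nonNeg : ∀ {i j} → 0ℤ ≤ i → i ≤ j → i * i ≤ j * j
square-mono-nonNeg {i} {j} 0≤i i≤j =
  ≤-trans (*-monoˡ-≤-nonNeg i {{nonNegative 0≤i}} i≤j)
          (*-monoʳ-≤-nonNeg j {{nonNegative (≤-trans 0≤i i≤j)}} i≤j)

square-antimono-neg : ∀ {i j} → j < 0ℤ → i ≤ j → j * j ≤ i * i
square-antimono-neg {i} {j} j<0 i≤j = subst₂ _≤_ (neg-square j) (neg-square i)
  (square-mono-nonNeg (neg-mono-≤ (<⇒≤ j<0)) (neg-mono-≤ i≤j))

square<⇒0<+ : ∀ {s t} → 0ℤ < s → t * t < s * s → 0ℤ < s + t
square<⇒0<+ {s} {t} 0<s t²<s² with 0ℤ <? s + t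
... | yes 0<s+t = 0<s+t
... | no s+t≯0 = ⊥-elim (<⇒≱ t²<s² (0≤i-j⇒j≤i (subst (0ℤ ≤_) (sym (factor s t))
        (*-nonNeg 0≤-[s+t] (<⇒≤ (+-mono-<-≤ 0<s (<⇒≤ (+-mono-<-≤ 0<s 0≤-[s+t]))))))))
  where
  0≤-[s+t] : 0ℤ ≤ - (s + t)
  0≤-[s+t] = neg-mono-≤ (≮⇒≥ s+t≯0)
  factor : ∀ s t → t * t - s * s ≡ - (s + t) * (s + (s + - (s + t)))
  factor = solve-∀

⊕-identityʳ : ∀ γ → γ ⊕ zeroOK ≡ γ
⊕-identityʳ (α , β) = cong₂ _,_ (+-identityʳ α) (+-identityʳ β)

pair-sum : ∀ γ₁ γ₂ {α} → sumOK (γ₁ ∷ γ₂ ∷ []) ≡ α → γ₁ ⊕ γ₂ ≡ α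
pair-sum γ₁ γ₂ eq = trans (cong (γ₁ ⊕_) (sym (⊕-identityʳ γ₂))) eq

pos+pos≡2 : ∀ {x y} → 0ℤ < x → 0ℤ < y → x + y ≡ + 2 → x ≡ 1ℤ × y ≡ 1ℤ
pos+pos≡2 {+[1+ zero ]} {+[1+ zero ]} _ _ _ = refl , refl
pos+pos≡2 {+[1+ zero ]} {+[1+ suc _ ]} _ _ ()
pos+pos≡2 {+[1+ suc zero ]} {+[1+ _ ]} _ _ ()
pos+pos≡2 {+[1+ suc (suc _) ]} {+[1+ _ ]} _ _ ()
pos+pos≡2 {+ zero} (+<+ ()) _ _
pos+pos≡2 {+[1+ _ ]} {+ zero} _ (+<+ ()) _

≤∧≤∧+≡⇒≡ : ∀ {m n k} → m ℕ.≤ k → n ℕ.≤ k → m ℕ.+ n ≡ k ℕ.+ k → m ≡ k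
≤∧≤∧+≡⇒≡ {m} {n} {k} m≤k n≤k eq =
  ℕₚ.≤-antisym m≤k (ℕₚ.+-cancelʳ-≤ k k m (subst (ℕ._≤ m ℕ.+ k) eq (ℕₚ.+-monoʳ-≤ m n≤k)))

k≤n/2⇒k+k≤n : ∀ {k n} → k ℕ.≤ n / 2 → k ℕ.+ k ℕ.≤ n
k≤n/2⇒k+k≤n {k} {n} k≤n/2 =
  ℕₚ.≤-trans (ℕₚ.+-mono-≤ k≤n/2 k≤n/2) (subst (ℕ._≤ n) n/2*2≡ (m/n*n≤m n 2))
  where
  n/2*2≡ : n / 2 ℕ.* 2 ≡ n / 2 ℕ.+ n / 2
  n/2*2≡ = trans (ℕₚ.*-comm (n / 2) 2) (cong (n / 2 ℕ.+_) (ℕₚ.+-identityʳ (n / 2)))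

-- A pair (u , v) stands for u + v√D.  It is positive iff its dominant term, compared through
-- the squares u² and v²D, is positive; the comparison is never an equality by irrationality.
module RealQuadratic (D : ℕ) (D≥2 : 2 ℕ.≤ D) (sf : Squarefree D) where

  Surd : Set
  Surd = ℤ × ℤ

  _·_ : Surd → Surd → Surd
  (u₁ , v₁) · (u₂ , v₂) = (u₁ * u₂ + + D * (v₁ * v₂) , u₁ * v₂ + v₁ * u₂)

  negate : Surd → Surd
  negate (u , v) = (- u , - v)

  Pos : Surd → Set
  Pos (u , v) = (0ℤ < u × v * v * + D < u * u) ⊎ (0ℤ < v × u * u < v * v * + D)

  0≤v²D : ∀ v → 0ℤ ≤ v * v * + D
  0≤v²D v = *-nonNeg (square-nonNeg v) (+≤+ z≤n)

  square≡⇒v≡0 : ∀ {u v} → u * u ≡ v * v * + D → v ≡ 0ℤ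
  square≡⇒v≡0 {u} {v} eq = ∣i∣≡0⇒i≡0 (sqrt-irrational D≥2 sf ∣ u ∣ ∣ v ∣ (begin
    ∣ u ∣ ℕ.* ∣ u ∣         ≡⟨ abs-* u u ⟨
    ∣ u * u ∣               ≡⟨ cong ∣_∣ (trans eq (*-comm (v * v) (+ D))) ⟩
    ∣ + D * (v * v) ∣       ≡⟨ abs-* (+ D) (v * v) ⟩
    D ℕ.* ∣ v * v ∣         ≡⟨ cong (D ℕ.*_) (abs-* v v) ⟩
    D ℕ.* (∣ v ∣ ℕ.* ∣ v ∣) ∎))
    where open ≡-Reasoning

  ·-comm : ∀ x y → x · y ≡ y · x
  ·-comm (u₁ , v₁) (u₂ , v₂) = cong₂ _,_ (swap₁ u₁ v₁ u₂ v₂ (+ D)) (swap₂ u₁ v₁ u₂ v₂)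
    where
    swap₁ : ∀ u₁ v₁ u₂ v₂ d → u₁ * u₂ + d * (v₁ * v₂) ≡ u₂ * u₁ + d * (v₂ * v₁)
    swap₁ = solve-∀
    swap₂ : ∀ u₁ v₁ u₂ v₂ → u₁ * v₂ + v₁ * u₂ ≡ u₂ * v₁ + v₂ * u₁
    swap₂ = solve-∀

  0<D : 0ℤ < + D
  0<D = +<+ (ℕₚ.<-≤-trans (s≤s z≤n) D≥2)

  private
    square-* : ∀ a b → (a * a) * (b * b) ≡ (a * b) * (a * b)
    square-* = solve-∀
    square-*D : ∀ a b → (a * a * + D) * (b * b * + D) ≡ (+ D * (a * b)) * (+ D * (a * b))
    square-*D a b = lemma a b (+ D)
      where
      lemma : ∀ a b d → (a * a * d) * (b * b * d) ≡ (d * (a * b)) * (d * (a * b))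
      lemma = solve-∀

  -- The norm of a product is the product of the norms, which decides the dominant term of x · y;
  -- that term is positive because its square exceeds the square of the other one (square<⇒0<+).
  Pos-· : ∀ x y → Pos x → Pos y → Pos (x · y)
  Pos-· (u₁ , v₁) (u₂ , v₂) (inj₁ (0<u₁ , lt₁)) (inj₁ (0<u₂ , lt₂)) =
    inj₁ ( square<⇒0<+ (*-pos 0<u₁ 0<u₂)
             (subst₂ _<_ (square-*D v₁ v₂) (square-* u₁ u₂)
               (*-mono-<-nonNeg (0≤v²D v₁) lt₁ (0≤v²D v₂) lt₂))
         , 0<i-j⇒j<i (subst (0ℤ <_) (sym (norm-· u₁ v₁ u₂ v₂ (+ D)))
             (*-pos (i<j⇒0<j-i lt₁) (i<j⇒0<j-i lt₂))) )
    where
    norm-· : ∀ u₁ v₁ u₂ v₂ d → let U = u₁ * u₂ + d * (v₁ * v₂) ; V = u₁ * v₂ + v₁ * u₂ in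
      U * U - V * V * d ≡ (u₁ * u₁ - v₁ * v₁ * d) * (u₂ * u₂ - v₂ * v₂ * d)
    norm-· = solve-∀
  Pos-· (u₁ , v₁) (u₂ , v₂) (inj₁ (0<u₁ , lt₁)) (inj₂ (0<v₂ , lt₂)) =
    inj₂ ( square<⇒0<+ (*-pos 0<u₁ 0<v₂)
             (*-cancelʳ-<-nonNeg (+ D) (subst₂ _<_ (regroupˡ (+ D) v₁ u₂) (regroupʳ (+ D) u₁ v₂)
               (*-mono-<-nonNeg (0≤v²D v₁) lt₁ (square-nonNeg u₂) lt₂)))
         , 0<i-j⇒j<i (subst (0ℤ <_) (sym (norm-· u₁ v₁ u₂ v₂ (+ D)))
             (*-pos (i<j⇒0<j-i lt₁) (i<j⇒0<j-i lt₂))) )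
    where
    regroupˡ : ∀ d a b → (a * a * d) * (b * b) ≡ (a * b) * (a * b) * d
    regroupˡ = solve-∀
    regroupʳ : ∀ d a b → (a * a) * (b * b * d) ≡ (a * b) * (a * b) * d
    regroupʳ = solve-∀
    norm-· : ∀ u₁ v₁ u₂ v₂ d → let U = u₁ * u₂ + d * (v₁ * v₂) ; V = u₁ * v₂ + v₁ * u₂ in
      V * V * d - U * U ≡ (u₁ * u₁ - v₁ * v₁ * d) * (v₂ * v₂ * d - u₂ * u₂)
    norm-· = solve-∀
  Pos-· x@(_ , _) y@(_ , _) px@(inj₂ _) py@(inj₁ _) = subst Pos (·-comm y x) (Pos-· y x py px)
  Pos-· (u₁ , v₁) (u₂ , v₂) (inj₂ (0<v₁ , lt₁)) (inj₂ (0<v₂ , lt₂)) =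
    inj₁ ( subst (0ℤ <_) (+-comm (+ D * (v₁ * v₂)) (u₁ * u₂))
             (square<⇒0<+ (*-pos 0<D (*-pos 0<v₁ 0<v₂))
               (subst₂ _<_ (square-* u₁ u₂) (square-*D v₁ v₂)
                 (*-mono-<-nonNeg (square-nonNeg u₁) lt₁ (square-nonNeg u₂) lt₂)))
         , 0<i-j⇒j<i (subst (0ℤ <_) (sym (norm-· u₁ v₁ u₂ v₂ (+ D)))
             (*-pos (i<j⇒0<j-i lt₁) (i<j⇒0<j-i lt₂))) )
    where
    norm-· : ∀ u₁ v₁ u₂ v₂ d → let U = u₁ * u₂ + d * (v₁ * v₂) ; V = u₁ * v₂ + v₁ * u₂ in
      U * U - V * V * d ≡ (v₁ * v₁ * d - u₁ * u₁) * (v₂ * v₂ * d - u₂ * u₂)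
    norm-· = solve-∀

  ¬Pos-0 : ¬ Pos (0ℤ , 0ℤ)
  ¬Pos-0 (inj₁ (0<0 , _)) = <-irrefl refl 0<0
  ¬Pos-0 (inj₂ (0<0 , _)) = <-irrefl refl 0<0

  Pos-negate-asym : ∀ w → Pos w → ¬ Pos (negate w)
  Pos-negate-asym (u , v) (inj₁ (0<u , _)) (inj₁ (0<-u , _)) = <-asym 0<u (neg-cancel-< 0<-u)
  Pos-negate-asym (u , v) (inj₂ (0<v , _)) (inj₂ (0<-v , _)) = <-asym 0<v (neg-cancel-< 0<-v)
  Pos-negate-asym (u , v) (inj₁ (_ , v²D<u²)) (inj₂ (_ , lt)) =
    <-asym v²D<u² (subst₂ _<_ (neg-square u) (cong (_* + D) (neg-square v)) lt)
  Pos-negate-asym (u , v) (inj₂ (_ , u²<v²D)) (inj₁ (_ , lt)) =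
    <-asym u²<v²D (subst₂ _<_ (cong (_* + D) (neg-square v)) (neg-square u) lt)

  Pos-trichotomy : ∀ w → Pos w ⊎ Pos (negate w) ⊎ w ≡ (0ℤ , 0ℤ)
  Pos-trichotomy (u , v) with <-cmp (v * v * + D) (u * u)
  ... | tri< v²D<u² _ _ with <-cmp 0ℤ u
  ...   | tri< 0<u _ _ = inj₁ (inj₁ (0<u , v²D<u²))
  ...   | tri≈ _ refl _ = ⊥-elim (<⇒≱ v²D<u² (0≤v²D v))
  ...   | tri> _ _ u<0 = inj₂ (inj₁ (inj₁ (neg-mono-< u<0 ,
            subst₂ _<_ (cong (_* + D) (sym (neg-square v))) (sym (neg-square u)) v²D<u²)))
  Pos-trichotomy (u , v) | tri> _ _ u²<v²D with <-cmp 0ℤ v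
  ...   | tri< 0<v _ _ = inj₁ (inj₂ (0<v , u²<v²D))
  ...   | tri≈ _ refl _ = ⊥-elim (<⇒≱ u²<v²D (square-nonNeg u))
  ...   | tri> _ _ v<0 = inj₂ (inj₁ (inj₂ (neg-mono-< v<0 ,
            subst₂ _<_ (sym (neg-square u)) (cong (_* + D) (sym (neg-square v))) u²<v²D)))
  Pos-trichotomy (u , v) | tri≈ _ v²D≡u² _ with square≡⇒v≡0 {u} {v} (sym v²D≡u²)
  ... | refl with i*j≡0⇒i≡0∨j≡0 u (sym v²D≡u²)
  ...   | inj₁ refl = inj₂ (inj₂ refl)
  ...   | inj₂ refl = inj₂ (inj₂ refl)

  Pos-cancelʳ : ∀ w c → Pos c → Pos (w · c) → Pos w
  Pos-cancelʳ w c pc pwc with Pos-trichotomy w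
  ... | inj₁ pw = pw
  ... | inj₂ (inj₁ p-w) = ⊥-elim (Pos-negate-asym (w · c) pwc (subst Pos (negate-· w c) (Pos-· _ c p-w pc)))
    where
    negate-· : ∀ w c → negate w · c ≡ negate (w · c)
    negate-· (u₁ , v₁) (u₂ , v₂) = cong₂ _,_ (lemma₁ u₁ v₁ u₂ v₂ (+ D)) (lemma₂ u₁ v₁ u₂ v₂)
      where
      lemma₁ : ∀ u₁ v₁ u₂ v₂ d → - u₁ * u₂ + d * (- v₁ * v₂) ≡ - (u₁ * u₂ + d * (v₁ * v₂))
      lemma₁ = solve-∀
      lemma₂ : ∀ u₁ v₁ u₂ v₂ → - u₁ * v₂ + - v₁ * u₂ ≡ - (u₁ * v₂ + v₁ * u₂)
      lemma₂ = solve-∀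
  ... | inj₂ (inj₂ refl) = ⊥-elim (¬Pos-0 (subst Pos (zero-· c) pwc))
    where
    zero-· : ∀ c → (0ℤ , 0ℤ) · c ≡ (0ℤ , 0ℤ)
    zero-· (u , v) = cong₂ _,_ (lemma₁ u v (+ D)) (lemma₂ u v)
      where
      lemma₁ : ∀ u v d → 0ℤ * u + d * (0ℤ * v) ≡ 0ℤ
      lemma₁ = solve-∀
      lemma₂ : ∀ u v → 0ℤ * v + 0ℤ * u ≡ 0ℤ
      lemma₂ = solve-∀

  Pos⇒PosSurd : ∀ {u v} → Pos (u , v) → PosSurd D u v
  Pos⇒PosSurd (inj₁ (0<u , v²D<u²)) = inj₁ (0<u , inj₂ v²D<u²)
  Pos⇒PosSurd (inj₂ (0<v , u²<v²D)) = inj₂ (0<v , inj₂ u²<v²D)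

  PosSurd⇒Pos : ∀ {u v} → PosSurd D u v → Pos (u , v)
  PosSurd⇒Pos {u} {v} p with <-cmp (v * v * + D) (u * u) | p
  ... | tri< v²D<u² _ _ | inj₁ (0<u , _) = inj₁ (0<u , v²D<u²)
  ... | tri< v²D<u² _ _ | inj₂ (_ , inj₂ u²<v²D) = ⊥-elim (<-asym v²D<u² u²<v²D)
  ... | tri< v²D<u² _ _ | inj₂ (_ , inj₁ 0≤u) = inj₁ (≤∧≢⇒< 0≤u 0≢u , v²D<u²)
    where
    0≢u : 0ℤ ≢ u
    0≢u refl = <⇒≱ v²D<u² (0≤v²D v)
  ... | tri> _ _ u²<v²D | inj₂ (0<v , _) = inj₂ (0<v , u²<v²D)
  ... | tri> _ _ u²<v²D | inj₁ (_ , inj₂ v²D<u²) = ⊥-elim (<-asym v²D<u² u²<v²D)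
  ... | tri> _ _ u²<v²D | inj₁ (_ , inj₁ 0≤v) = inj₂ (≤∧≢⇒< 0≤v 0≢v , u²<v²D)
    where
    0≢v : 0ℤ ≢ v
    0≢v refl = <⇒≱ u²<v²D (square-nonNeg u)
  ... | tri≈ _ v²D≡u² _ | inj₁ (0<u , _) = ⊥-elim (<-irrefl v²D≡u²
        (subst (λ v → v * v * + D < u * u) (sym (square≡⇒v≡0 {u} {v} (sym v²D≡u²))) (*-pos 0<u 0<u)))
  ... | tri≈ _ v²D≡u² _ | inj₂ (0<v , _) = ⊥-elim (<-irrefl (sym (square≡⇒v≡0 {u} {v} (sym v²D≡u²))) 0<v)

  PosSurd⇔Pos : ∀ {u v u′ v′} → u ≡ u′ → v ≡ v′ → PosSurd D u v ⇔ Pos (u′ , v′)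
  PosSurd⇔Pos refl refl = mk⇔ PosSurd⇒Pos Pos⇒PosSurd

  PosSurd-monoˡ : ∀ {u u′ v} → u ≤ u′ → PosSurd D u v → PosSurd D u′ v
  PosSurd-monoˡ u≤u′ (inj₁ (0<u , inj₁ 0≤v)) = inj₁ (<-≤-trans 0<u u≤u′ , inj₁ 0≤v)
  PosSurd-monoˡ u≤u′ (inj₁ (0<u , inj₂ lt)) =
    inj₁ (<-≤-trans 0<u u≤u′ , inj₂ (<-≤-trans lt (square-mono-nonNeg (<⇒≤ 0<u) u≤u′)))
  PosSurd-monoˡ u≤u′ (inj₂ (0<v , inj₁ 0≤u)) = inj₂ (0<v , inj₁ (≤-trans 0≤u u≤u′))
  PosSurd-monoˡ {u′ = u′} u≤u′ (inj₂ (0<v , inj₂ lt)) with 0ℤ ≤? u′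
  ... | yes 0≤u′ = inj₂ (0<v , inj₁ 0≤u′)
  ... | no u′≱0 = inj₂ (0<v , inj₂ (≤-<-trans (square-antimono-neg (≰⇒> u′≱0) u≤u′) lt))

  Pos-monoˡ : ∀ {u u′ v} → u ≤ u′ → Pos (u , v) → Pos (u′ , v)
  Pos-monoˡ u≤u′ p = PosSurd⇒Pos (PosSurd-monoˡ u≤u′ (Pos⇒PosSurd p))

  Pos-rational : ∀ {q} → 0ℤ < q → Pos (q , 0ℤ)
  Pos-rational 0<q = inj₁ (0<q , *-pos 0<q 0<q)

  Pos-scale : ∀ {k u v} → 0ℤ < k → Pos (u , v) → Pos (k * u , k * v)
  Pos-scale {k} {u} {v} 0<k p =
    subst Pos (cong₂ _,_ (lemma₁ k u v (+ D)) (lemma₂ k u v)) (Pos-· (k , 0ℤ) (u , v) (Pos-rational 0<k) p)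
    where
    lemma₁ : ∀ k u v d → k * u + d * (0ℤ * v) ≡ k * u
    lemma₁ = solve-∀
    lemma₂ : ∀ k u v → k * v + 0ℤ * u ≡ k * v
    lemma₂ = solve-∀

  Pos-transfer : ∀ {c q} w w′ → Pos c → 0ℤ < q → w · c ≡ (q , 0ℤ) · w′ → Pos w ⇔ Pos w′
  Pos-transfer {c} {q} w w′ pc 0<q eq = mk⇔
    (λ pw → Pos-cancelʳ w′ (q , 0ℤ) (Pos-rational 0<q)
              (subst Pos (trans eq (·-comm (q , 0ℤ) w′)) (Pos-· w c pw pc)))
    (λ pw′ → Pos-cancelʳ w c pc (subst Pos (sym eq) (Pos-· (q , 0ℤ) w′ (Pos-rational 0<q) pw′)))

  Pos-± : ∀ {u v} → Pos (u , v) → Pos (- u , v) → 0ℤ < v × u * u < v * v * + D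
  Pos-± (inj₂ 0<v×u²<v²D) _ = 0<v×u²<v²D
  Pos-± {u} (inj₁ _) (inj₂ (0<v , lt)) = 0<v , subst (_< _) (neg-square u) lt
  Pos-± (inj₁ (0<u , _)) (inj₁ (0<-u , _)) = ⊥-elim (<-asym 0<u (neg-cancel-< 0<-u))

  ≤√⇒Pos : ∀ {c} → c ≤√ D → Pos (- c , 1ℤ)
  ≤√⇒Pos (inj₁ c≤0) = PosSurd⇒Pos (inj₂ (+<+ (s≤s z≤n) , inj₁ (neg-mono-≤ c≤0)))
  ≤√⇒Pos {c} (inj₂ c²≤D) =
    inj₂ (+<+ (s≤s z≤n) , subst₂ _<_ (sym (neg-square c)) (sym (*-identityˡ (+ D))) (≤∧≢⇒< c²≤D c²≢D))
    where
    c²≢D : c * c ≢ + D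
    c²≢D c²≡D with square≡⇒v≡0 {c} {1ℤ} (trans c²≡D (sym (*-identityˡ (+ D))))
    ... | ()

  ≰√⇒Pos : ∀ {c} → ¬ c ≤√ D → Pos (c , -1ℤ)
  ≰√⇒Pos {c} c≰√D =
    inj₁ (≰⇒> (c≰√D ∘ inj₁) , subst (_< c * c) (sym (*-identityˡ (+ D))) (≰⇒> (c≰√D ∘ inj₂)))

-- The first coordinate X is additive and at least 1 on totally positive elements, so it bounds the
-- number of parts: an element with X = 2 is a single part or the sum of two atoms (X = 1).
module Counting (D A : ℕ) (h : OK → ℤ × ℤ) (g : ℤ × ℤ → OK)
  (g∘h : ∀ γ → g (h γ) ≡ γ) (h∘g : ∀ z → h (g z) ≡ z)
  (h-⊕ : ∀ γ δ → h (γ ⊕ δ) ≡ h γ ⊕ h δ) (h-0 : h zeroOK ≡ zeroOK)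
  (0<h₁ : ∀ {γ} → TotPos D γ → 0ℤ < proj₁ (h γ))
  (TotPos-g₁⇔ : ∀ y → TotPos D (g (1ℤ , y)) ⇔ (- + A ≤ y × y ≤ 0ℤ))
  (TotPos-g-double : ∀ {x y} → TotPos D (g (x , y)) → TotPos D (g (+ 2 * x , + 2 * y))) where

  X : OK → ℤ
  X γ = proj₁ (h γ)

  length≤X-sum : ∀ {L} → All (TotPos D) L → + length L ≤ X (sumOK L)
  length≤X-sum [] = subst (λ z → 0ℤ ≤ proj₁ z) (sym h-0) ≤-refl
  length≤X-sum {γ ∷ L} (pγ ∷ pL) = subst (λ z → + length (γ ∷ L) ≤ proj₁ z) (sym (h-⊕ γ (sumOK L)))
    (+-mono-≤ (i<j⇒suc[i]≤j (0<h₁ pγ)) (length≤X-sum pL))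

  length≤X : ∀ {α L} → IsPartition D α L → + length L ≤ X α
  length≤X (_ , pL , sum≡α) = subst (λ γ → _ ≤ X γ) sum≡α (length≤X-sum pL)

  singleton-partition : ∀ {α γ} → IsPartition D α (γ ∷ []) → γ ∷ [] ↭ α ∷ []
  singleton-partition {γ = γ} (_ , _ , γ⊕0≡α) =
    ↭-reflexive (cong (_∷ []) (trans (sym (⊕-identityʳ γ)) γ⊕0≡α))

  atom : ℕ → OK
  atom n = g (1ℤ , - + n)

  atom-TotPos : ∀ {n} → n ℕ.≤ A → TotPos D (atom n)
  atom-TotPos n≤A = Equivalence.from (TotPos-g₁⇔ _) (neg-mono-≤ (+≤+ n≤A) , neg-mono-≤ (+≤+ z≤n))

  atom-injective : ∀ {m n} → atom m ≡ atom n → m ≡ n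
  atom-injective {m} {n} eq = +-injective (neg-injective (begin
    - + m              ≡⟨ cong proj₂ (h∘g (1ℤ , - + m)) ⟨
    proj₂ (h (atom m)) ≡⟨ cong (proj₂ ∘ h) eq ⟩
    proj₂ (h (atom n)) ≡⟨ cong proj₂ (h∘g (1ℤ , - + n)) ⟩
    - + n              ∎))
    where open ≡-Reasoning

  h-atom⊕atom : ∀ m n → h (atom m ⊕ atom n) ≡ (+ 2 , - + (m ℕ.+ n))
  h-atom⊕atom m n = trans (h-⊕ (atom m) (atom n)) (trans (cong₂ _⊕_ (h∘g _) (h∘g _))
    (cong (+ 2 ,_) (trans (sym (neg-distrib-+ (+ m) (+ n))) (cong -_ (sym (pos-+ m n))))))

  TotPos∧X≡1⇒atom : ∀ {γ} → TotPos D γ → X γ ≡ 1ℤ → ∃ λ n → n ℕ.≤ A × γ ≡ atom n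
  TotPos∧X≡1⇒atom {γ} pγ X≡1 = ∣ y ∣ , ∣y∣≤A , trans γ≡ (cong (λ t → g (1ℤ , t)) y≡)
    where
    y = proj₂ (h γ)
    γ≡ : γ ≡ g (1ℤ , y)
    γ≡ = trans (sym (g∘h γ)) (cong (λ x → g (x , y)) X≡1)
    bounds : - + A ≤ y × y ≤ 0ℤ
    bounds = Equivalence.to (TotPos-g₁⇔ y) (subst (TotPos D) γ≡ pγ)
    y≡ : y ≡ - + ∣ y ∣
    y≡ = trans (sym (neg-involutive y))
               (cong -_ (trans (sym (0≤i⇒+∣i∣≡i (neg-mono-≤ (proj₂ bounds)))) (cong +_ (∣-i∣≡∣i∣ y))))
    ∣y∣≤A : ∣ y ∣ ℕ.≤ A
    ∣y∣≤A = drop‿+≤+ (neg-cancel-≤ (subst (- + A ≤_) y≡ (proj₁ bounds)))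

  count-one : HasNumPartitions D (atom 0) 1
  count-one =
    (λ _ → atom 0 ∷ []) , (λ _ → (λ ()) , atom-TotPos z≤n ∷ [] , ⊕-identityʳ (atom 0)) , distinct , complete
    where
    distinct : ∀ i j → atom 0 ∷ [] ↭ atom 0 ∷ [] → i ≡ j
    distinct zero zero _ = refl
    X≡1 : X (atom 0) ≡ 1ℤ
    X≡1 = cong proj₁ (h∘g (1ℤ , 0ℤ))
    complete : ∀ L → IsPartition D (atom 0) L → ∃ λ i → L ↭ atom 0 ∷ []
    complete [] (L≢[] , _) = ⊥-elim (L≢[] refl)
    complete (γ ∷ []) part = zero , singleton-partition part
    complete L@(_ ∷ _ ∷ _) part with subst (+ length L ≤_) X≡1 (length≤X part)
    ... | +≤+ (s≤s ())

  module KPlusTwo (k : ℕ) (2k≤A : k ℕ.+ k ℕ.≤ A) where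

    β : OK
    β = g (+ 2 , - + (k ℕ.+ k))

    β≡atom⊕atom : ∀ {n} → n ℕ.≤ k ℕ.+ k → β ≡ atom n ⊕ atom (k ℕ.+ k ℕ.∸ n)
    β≡atom⊕atom n≤2k = trans (cong (λ m → g (+ 2 , - + m)) (sym (ℕₚ.m+[n∸m]≡n n≤2k)))
                       (trans (sym (cong g (h-atom⊕atom _ _))) (g∘h _))

    TotPos-β : TotPos D β
    TotPos-β = subst (λ y → TotPos D (g (+ 2 , y))) (double (+ k)) (TotPos-g-double (atom-TotPos k≤A))
      where
      k≤A = ℕₚ.≤-trans (ℕₚ.m≤m+n k k) 2k≤A
      double : ∀ x → + 2 * - x ≡ - (x + x)
      double = solve-∀

    pairs : Fin (suc k) → List OK
    pairs j = atom (toℕ j) ∷ atom (k ℕ.+ k ℕ.∸ toℕ j) ∷ []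

    partitions : Fin (suc (suc k)) → List OK
    partitions zero = β ∷ []
    partitions (suc j) = pairs j

    is-partition : ∀ i → IsPartition D β (partitions i)
    is-partition zero = (λ ()) , TotPos-β ∷ [] , ⊕-identityʳ β
    is-partition (suc j) =
      (λ ()) ,
      atom-TotPos (ℕₚ.≤-trans (toℕ≤pred[n] j) (ℕₚ.≤-trans (ℕₚ.m≤m+n k k) 2k≤A)) ∷
      atom-TotPos (ℕₚ.≤-trans (ℕₚ.m∸n≤m (k ℕ.+ k) (toℕ j)) 2k≤A) ∷ [] ,
      trans (cong (atom (toℕ j) ⊕_) (⊕-identityʳ _))
            (sym (β≡atom⊕atom (ℕₚ.≤-trans (toℕ≤pred[n] j) (ℕₚ.m≤m+n k k))))

    distinct : ∀ i i′ → partitions i ↭ partitions i′ → i ≡ i′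
    distinct zero zero _ = refl
    distinct zero (suc _) p with ↭-length p
    ... | ()
    distinct (suc _) zero p with ↭-length p
    ... | ()
    distinct (suc j) (suc j′) p = cong suc (toℕ-injective (index (∈-resp-↭ p (here refl))))
      where
      index : atom (toℕ j) ∈ pairs j′ → toℕ j ≡ toℕ j′
      index (here eq) = atom-injective eq
      index (there (here eq)) =
        trans (≤∧≤∧+≡⇒≡ (toℕ≤pred[n] j) (toℕ≤pred[n] j′) sum)
              (sym (≤∧≤∧+≡⇒≡ (toℕ≤pred[n] j′) (toℕ≤pred[n] j) (trans (ℕₚ.+-comm (toℕ j′) (toℕ j)) sum)))
        where
        sum : toℕ j ℕ.+ toℕ j′ ≡ k ℕ.+ k
        sum = trans (cong (ℕ._+ toℕ j′) (atom-injective eq))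
                    (ℕₚ.m∸n+n≡m (ℕₚ.≤-trans (toℕ≤pred[n] j′) (ℕₚ.m≤m+n k k)))
      index (there (there ()))

    ordered-pair : ∀ {n₁ n₂} (n₁≤k : n₁ ℕ.≤ k) → n₁ ℕ.+ n₂ ≡ k ℕ.+ k →
                   atom n₁ ∷ atom n₂ ∷ [] ≡ pairs (fromℕ< (s≤s n₁≤k))
    ordered-pair {n₁} {n₂} n₁≤k eq rewrite toℕ-fromℕ< (s≤s n₁≤k) =
      cong (λ n → atom n₁ ∷ atom n ∷ []) (trans (sym (ℕₚ.m+n∸m≡n n₁ n₂)) (cong (ℕ._∸ n₁) eq))

    pair-complete : ∀ {n₁ n₂} → n₁ ℕ.+ n₂ ≡ k ℕ.+ k → ∃ λ i → atom n₁ ∷ atom n₂ ∷ [] ↭ partitions i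
    pair-complete {n₁} {n₂} eq with n₁ ℕ.≤? k
    ... | yes n₁≤k = suc (fromℕ< (s≤s n₁≤k)) , ↭-reflexive (ordered-pair n₁≤k eq)
    ... | no n₁≰k = suc (fromℕ< (s≤s n₂≤k)) ,
                    ↭-trans (swap _ _ ↭-refl) (↭-reflexive (ordered-pair n₂≤k (trans (ℕₚ.+-comm n₂ n₁) eq)))
      where
      n₂≤k : n₂ ℕ.≤ k
      n₂≤k = ℕₚ.+-cancelˡ-≤ k n₂ k
               (subst (k ℕ.+ n₂ ℕ.≤_) eq (ℕₚ.+-monoˡ-≤ n₂ (ℕₚ.<⇒≤ (ℕₚ.≰⇒> n₁≰k))))

    X-β : X β ≡ + 2
    X-β = cong proj₁ (h∘g _)

    pair-decompose : ∀ {γ₁ γ₂} → TotPos D γ₁ → TotPos D γ₂ → γ₁ ⊕ γ₂ ≡ β →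
                     ∃₂ λ n₁ n₂ → γ₁ ≡ atom n₁ × γ₂ ≡ atom n₂
    pair-decompose {γ₁} {γ₂} p₁ p₂ γ₁⊕γ₂≡β =
      let X+X≡2 = trans (cong proj₁ (sym (h-⊕ γ₁ γ₂))) (trans (cong X γ₁⊕γ₂≡β) X-β)
          (X≡1 , X≡1′) = pos+pos≡2 (0<h₁ p₁) (0<h₁ p₂) X+X≡2
          (n₁ , _ , γ₁≡) = TotPos∧X≡1⇒atom p₁ X≡1
          (n₂ , _ , γ₂≡) = TotPos∧X≡1⇒atom p₂ X≡1′
      in n₁ , n₂ , γ₁≡ , γ₂≡

    complete : ∀ L → IsPartition D β L → ∃ λ i → L ↭ partitions i
    complete [] (L≢[] , _) = ⊥-elim (L≢[] refl)
    complete (γ ∷ []) part = zero , singleton-partition part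
    complete L@(_ ∷ _ ∷ _ ∷ _) part with subst (+ length L ≤_) X-β (length≤X part)
    ... | +≤+ (s≤s (s≤s ()))
    complete (γ₁ ∷ γ₂ ∷ []) (_ , p₁ ∷ p₂ ∷ [] , sum≡β) with pair-decompose p₁ p₂ (pair-sum γ₁ γ₂ sum≡β)
    ... | n₁ , n₂ , refl , refl = pair-complete (+-injective (neg-injective (cong proj₂ (begin
      (+ 2 , - + (n₁ ℕ.+ n₂))  ≡⟨ h-atom⊕atom n₁ n₂ ⟨
      h (atom n₁ ⊕ atom n₂)    ≡⟨ cong h (pair-sum (atom n₁) (atom n₂) sum≡β) ⟩
      h β                      ≡⟨ h∘g _ ⟩
      (+ 2 , - + (k ℕ.+ k))    ∎))))
      where open ≡-Reasoning

    count : HasNumPartitions D β (suc (suc k))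
    count = partitions , is-partition , distinct , complete

  partition-counts : ∀ m → 1 ℕ.≤ m → m ℕ.≤ A / 2 ℕ.+ 2 → Σ OK λ α → TotPos D α × HasNumPartitions D α m
  partition-counts (suc zero) _ _ = atom 0 , atom-TotPos z≤n , count-one
  partition-counts (suc (suc k)) _ k+2≤ = β , TotPos-β , count
    where
    k≤A/2 : k ℕ.≤ A / 2
    k≤A/2 = ℕₚ.+-cancelʳ-≤ 2 k (A / 2) (subst (ℕ._≤ A / 2 ℕ.+ 2) (ℕₚ.+-comm 2 k) k+2≤)
    open KPlusTwo k (k≤n/2⇒k+k≤n k≤A/2)

module ContinuedFraction (D : ℕ) (D≥2 : 2 ℕ.≤ D) (sf : Squarefree D)
  (a : ℕ → ℕ) (P Q : ℕ → ℤ)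
  (init : InitialPQ D (P 0) (Q 0))
  (floor : ∀ n → IsFloor D (+ a n) (P n) (Q n))
  (P-rec : ∀ n → P (suc n) ≡ + a n * Q n - P n)
  (Q-rec : ∀ n → Q (suc n) * Q n ≡ + D - P (suc n) * P (suc n)) where

  open RealQuadratic D D≥2 sf

  -- The complete quotient ξₙ = (Pₙ + √D)/Qₙ is reduced: Qₙ > 0, ξ̄ₙ < 0 and ξₙ > 1.
  record Reduced (n : ℕ) : Set where
    field
      0<Q    : 0ℤ < Q n
      P<√D   : Pos (- P n , 1ℤ)
      Q<P+√D : Pos (P n - Q n , 1ℤ)

  module Step {n : ℕ} (reducedₙ : Reduced n) where
    open Reduced reducedₙ

    private
      A = + a n
      P′ = P (suc n)
      Q′ = Q (suc n)

      floor-bounds : (A * Q n - P n) ≤√ D × ¬ ((A + 1ℤ) * Q n - P n) ≤√ D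
      floor-bounds with floor n
      ... | inj₁ (_ , lower , upper) = lower , upper
      ... | inj₂ (Q<0 , _) = ⊥-elim (<-asym 0<Q Q<0)

    P′<√D : Pos (- P′ , 1ℤ)
    P′<√D = subst (λ p → Pos (- p , 1ℤ)) (sym (P-rec n)) (≤√⇒Pos (proj₁ floor-bounds))

    √D<P′+Q : Pos (P′ + Q n , -1ℤ)
    √D<P′+Q = subst (λ u → Pos (u , -1ℤ)) (trans (expand A (Q n) (P n)) (cong (_+ Q n) (sym (P-rec n))))
                (≰√⇒Pos (proj₂ floor-bounds))
      where
      expand : ∀ a q p → (a + 1ℤ) * q - p ≡ (a * q - p) + q
      expand = solve-∀

    -√D<P′ : Pos (P′ , 1ℤ)
    -√D<P′ = Pos-monoˡ (subst (- P n ≤_) (sym (P-rec n)) -P≤AQ-P) P<√D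
      where
      -P≤AQ-P : - P n ≤ A * Q n - P n
      -P≤AQ-P = i≤j+i (- P n) (A * Q n) {{nonNegative (*-nonNeg {A} (+≤+ z≤n) (<⇒≤ 0<Q))}}

    1≤a : 1 ℕ.≤ a n
    1≤a with a n in aₙ≡
    ... | suc _ = s≤s z≤n
    ... | zero =
      ⊥-elim (Pos-negate-asym (P n - Q n , 1ℤ) Q<P+√D (subst (λ u → Pos (u , -1ℤ)) P′+Q≡ √D<P′+Q))
      where
      simplify : ∀ p q → (0ℤ * q - p) + q ≡ - (p - q)
      simplify = solve-∀
      P′+Q≡ : P′ + Q n ≡ - (P n - Q n)
      P′+Q≡ = trans (cong (_+ Q n) (trans (P-rec n) (cong (λ k → + k * Q n - P n) aₙ≡))) (simplify (P n) (Q n))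

    private
      Pos-/Q : ∀ {x y} w → x · y ≡ w · (Q n , 0ℤ) → Pos x → Pos y → Pos w
      Pos-/Q w eq px py = Pos-cancelʳ w (Q n , 0ℤ) (Pos-rational 0<Q) (subst Pos eq (Pos-· _ _ px py))

    0<Q′ : 0ℤ < Q′
    0<Q′ = *-cancelʳ-<-nonNeg (Q n) {{nonNegative (<⇒≤ 0<Q)}}
             (subst₂ _<_ (sym (*-zeroˡ (Q n))) (sym (Q-rec n)) (i<j⇒0<j-i P′²<D))
      where
      P′²<D : P′ * P′ < + D
      P′²<D = subst (P′ * P′ <_) (*-identityˡ (+ D)) (proj₂ (Pos-± -√D<P′ P′<√D))

    Q′<P′+√D : Pos (P′ - Q′ , 1ℤ)
    Q′<P′+√D = Pos-/Q (P′ - Q′ , 1ℤ) (cong₂ _,_ first (second P′ (Q n) Q′)) -√D<P′ √D<P′+Q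
      where
      open ≡-Reasoning
      expand : ∀ p q d → p * (p + q) + d * (1ℤ * -1ℤ) ≡ p * q - (d - p * p)
      expand = solve-∀
      collect : ∀ p q q′ d → p * q - q′ * q ≡ (p - q′) * q + d * (1ℤ * 0ℤ)
      collect = solve-∀
      first : P′ * (P′ + Q n) + + D * (1ℤ * -1ℤ) ≡ (P′ - Q′) * Q n + + D * (1ℤ * 0ℤ)
      first = begin
        P′ * (P′ + Q n) + + D * (1ℤ * -1ℤ)  ≡⟨ expand P′ (Q n) (+ D) ⟩
        P′ * Q n - (+ D - P′ * P′)          ≡⟨ cong (λ t → P′ * Q n - t) (Q-rec n) ⟨
        P′ * Q n - Q′ * Q n                 ≡⟨ collect P′ (Q n) Q′ (+ D) ⟩
        (P′ - Q′) * Q n + + D * (1ℤ * 0ℤ)   ∎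
      second : ∀ p q q′ → p * -1ℤ + 1ℤ * (p + q) ≡ (p - q′) * 0ℤ + 1ℤ * q
      second = solve-∀

    √D<Q′+P′ : Pos (Q′ + P′ , -1ℤ)
    √D<Q′+P′ = Pos-/Q (Q′ + P′ , -1ℤ) (cong₂ _,_ first (second P′ (Q n) Q′)) P′<√D Q<P′+√D
      where
      open ≡-Reasoning
      Q<P′+√D : Pos (P′ - Q n , 1ℤ)
      Q<P′+√D = Pos-monoˡ (subst (- P n ≤_) (sym P′-Q≡) -P≤[A-1]Q-P) P<√D
        where
        P′-Q≡ : P′ - Q n ≡ (A - 1ℤ) * Q n - P n
        P′-Q≡ = trans (cong (_- Q n) (P-rec n)) (regroup A (Q n) (P n))
          where
          regroup : ∀ a q p → a * q - p - q ≡ (a - 1ℤ) * q - p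
          regroup = solve-∀
        0≤A-1 : 0ℤ ≤ A - 1ℤ
        0≤A-1 = i≤j⇒0≤j-i (+≤+ 1≤a)
        -P≤[A-1]Q-P : - P n ≤ (A - 1ℤ) * Q n - P n
        -P≤[A-1]Q-P = i≤j+i (- P n) ((A - 1ℤ) * Q n) {{nonNegative (*-nonNeg 0≤A-1 (<⇒≤ 0<Q))}}
      expand : ∀ p q d → - p * (p - q) + d * (1ℤ * 1ℤ) ≡ (d - p * p) + p * q
      expand = solve-∀
      collect : ∀ p q q′ d → q′ * q + p * q ≡ (q′ + p) * q + d * (-1ℤ * 0ℤ)
      collect = solve-∀
      first : - P′ * (P′ - Q n) + + D * (1ℤ * 1ℤ) ≡ (Q′ + P′) * Q n + + D * (-1ℤ * 0ℤ)
      first = begin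
        - P′ * (P′ - Q n) + + D * (1ℤ * 1ℤ)  ≡⟨ expand P′ (Q n) (+ D) ⟩
        (+ D - P′ * P′) + P′ * Q n           ≡⟨ cong (_+ P′ * Q n) (Q-rec n) ⟨
        Q′ * Q n + P′ * Q n                  ≡⟨ collect P′ (Q n) Q′ (+ D) ⟩
        (Q′ + P′) * Q n + + D * (-1ℤ * 0ℤ)   ∎
      second : ∀ p q q′ → - p * 1ℤ + 1ℤ * (p - q) ≡ (q′ + p) * 0ℤ + -1ℤ * q
      second = solve-∀

    reduced-suc : Reduced (suc n)
    reduced-suc = record { 0<Q = 0<Q′ ; P<√D = P′<√D ; Q<P+√D = Q′<P′+√D }

  reduced-init : ∀ {P₀ Q₀} → InitialPQ D P₀ Q₀ → 0ℤ < Q₀ × Pos (- P₀ , 1ℤ) × Pos (P₀ - Q₀ , 1ℤ)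
  reduced-init h with D % 4 ℕₚ.≟ 1
  reduced-init (refl , refl) | yes _ = +<+ (s≤s z≤n) , ≤√⇒Pos 1≤√D , ≤√⇒Pos 1≤√D
    where 1≤√D = inj₂ (+≤+ (ℕₚ.<-≤-trans (s≤s z≤n) D≥2))
  reduced-init (refl , refl) | no _ = +<+ (s≤s z≤n) , ≤√⇒Pos (inj₁ ≤-refl) , ≤√⇒Pos 1≤√D
    where 1≤√D = inj₂ (+≤+ (ℕₚ.<-≤-trans (s≤s z≤n) D≥2))

  reduced : ∀ n → Reduced n
  reduced zero = let (0<Q , P<√D , Q<P+√D) = reduced-init init in
    record { 0<Q = 0<Q ; P<√D = P<√D ; Q<P+√D = Q<P+√D }
  reduced (suc n) = Step.reduced-suc (reduced n)

  module Stepₙ (n : ℕ) = Step (reduced n)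

  -- The two components of (Pₙ + √D)(Pₙ₊₁ + √D) = Qₙ(aₙ(Pₙ₊₁ + √D) + Qₙ₊₁), i.e. ξₙξₙ₊₁ = aₙξₙ₊₁ + 1.
  P+P′≡aQ : ∀ n → P n + P (suc n) ≡ + a n * Q n
  P+P′≡aQ n = trans (cong (λ t → P n + t) (P-rec n)) (cancel (P n) (+ a n * Q n))
    where
    cancel : ∀ p s → p + (s - p) ≡ s
    cancel = solve-∀

  PP′+D≡Q[aP′+Q′] : ∀ n → P n * P (suc n) + + D ≡ Q n * (+ a n * P (suc n) + Q (suc n))
  PP′+D≡Q[aP′+Q′] n = begin
    P n * P′ + + D                     ≡⟨ split (P n) P′ (+ D) ⟩
    (P n + P′) * P′ + (+ D - P′ * P′)  ≡⟨ cong₂ (λ s t → s * P′ + t) (P+P′≡aQ n) (sym (Q-rec n)) ⟩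
    + a n * Q n * P′ + Q′ * Q n        ≡⟨ collect (+ a n) (Q n) P′ Q′ ⟩
    Q n * (+ a n * P′ + Q′)            ∎
    where
    open ≡-Reasoning
    P′ = P (suc n)
    Q′ = Q (suc n)
    split : ∀ p p′ d → p * p′ + d ≡ (p + p′) * p′ + (d - p′ * p′)
    split = solve-∀
    collect : ∀ a q p′ q′ → a * q * p′ + q′ * q ≡ q * (a * p′ + q′)
    collect = solve-∀

  sgn : ℕ → ℤ
  sgn zero = 1ℤ
  sgn (suc n) = - sgn n

  -- At level n the pair (x , y) stands for Qₙ(xξₙ + y) = x(Pₙ + √D) + yQₙ.  As ξ̄ₙ₊₁ < 0, each
  -- step of the expansion flips the sign of the conjugate embedding; sgn n = (-1)ⁿ undoes this.
  level : ℕ → ℤ × ℤ → Surd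
  level n (x , y) = (x * P n + y * Q n , x)

  level-conj : ℕ → ℤ × ℤ → Surd
  level-conj n (x , y) = (sgn n * (x * P n + y * Q n) , - (sgn n * x))

  TotPosAt : ℕ → ℤ × ℤ → Set
  TotPosAt n z = Pos (level n z) × Pos (level-conj n z)

  cf-step : ℕ → ℤ × ℤ → ℤ × ℤ
  cf-step n (x , y) = (+ a n * x + y , x)

  level-step : ∀ n z → level n z · (P (suc n) , 1ℤ) ≡ (Q n , 0ℤ) · level (suc n) (cf-step n z)
  level-step n (x , y) = cong₂ _,_
    (begin
      (x * P n + y * Q n) * P′ + + D * (x * 1ℤ)
        ≡⟨ expand₁ x y (P n) (Q n) P′ (+ D) ⟩
      x * (P n * P′ + + D) + y * Q n * P′
        ≡⟨ cong (λ t → x * t + y * Q n * P′) (PP′+D≡Q[aP′+Q′] n) ⟩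
      x * (Q n * (A * P′ + Q′)) + y * Q n * P′
        ≡⟨ collect₁ x y A (Q n) P′ Q′ (+ D) ⟩
      Q n * ((A * x + y) * P′ + x * Q′) + + D * (0ℤ * (A * x + y)) ∎)
    (begin
      (x * P n + y * Q n) * 1ℤ + x * P′
        ≡⟨ expand₂ x y (P n) (Q n) P′ ⟩
      x * (P n + P′) + y * Q n
        ≡⟨ cong (λ t → x * t + y * Q n) (P+P′≡aQ n) ⟩
      x * (A * Q n) + y * Q n
        ≡⟨ collect₂ x y A (Q n) P′ Q′ ⟩
      Q n * (A * x + y) + 0ℤ * ((A * x + y) * P′ + x * Q′) ∎)
    where
    open ≡-Reasoning
    A = + a n
    P′ = P (suc n)
    Q′ = Q (suc n)
    expand₁ : ∀ x y p q p′ d → (x * p + y * q) * p′ + d * (x * 1ℤ) ≡ x * (p * p′ + d) + y * q * p′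
    expand₁ = solve-∀
    collect₁ : ∀ x y a q p′ q′ d →
      x * (q * (a * p′ + q′)) + y * q * p′ ≡ q * ((a * x + y) * p′ + x * q′) + d * (0ℤ * (a * x + y))
    collect₁ = solve-∀
    expand₂ : ∀ x y p q p′ → (x * p + y * q) * 1ℤ + x * p′ ≡ x * (p + p′) + y * q
    expand₂ = solve-∀
    collect₂ : ∀ x y a q p′ q′ → x * (a * q) + y * q ≡ q * (a * x + y) + 0ℤ * ((a * x + y) * p′ + x * q′)
    collect₂ = solve-∀

  level-conj-step : ∀ n z → level-conj n z · (- P (suc n) , 1ℤ) ≡ (Q n , 0ℤ) · level-conj (suc n) (cf-step n z)
  level-conj-step n (x , y) = cong₂ _,_
    (begin
      s * (x * P n + y * Q n) * - P′ + + D * (- (s * x) * 1ℤ)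
        ≡⟨ expand₁ s x y (P n) (Q n) P′ (+ D) ⟩
      - s * (x * (P n * P′ + + D) + y * Q n * P′)
        ≡⟨ cong (λ t → - s * (x * t + y * Q n * P′)) (PP′+D≡Q[aP′+Q′] n) ⟩
      - s * (x * (Q n * (A * P′ + Q′)) + y * Q n * P′)
        ≡⟨ collect₁ s x y A (Q n) P′ Q′ (+ D) ⟩
      Q n * (- s * ((A * x + y) * P′ + x * Q′)) + + D * (0ℤ * - (- s * (A * x + y))) ∎)
    (begin
      s * (x * P n + y * Q n) * 1ℤ + - (s * x) * - P′
        ≡⟨ expand₂ s x y (P n) (Q n) P′ ⟩
      s * (x * (P n + P′) + y * Q n)
        ≡⟨ cong (λ t → s * (x * t + y * Q n)) (P+P′≡aQ n) ⟩
      s * (x * (A * Q n) + y * Q n)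
        ≡⟨ collect₂ s x y A (Q n) P′ Q′ ⟩
      Q n * - (- s * (A * x + y)) + 0ℤ * (- s * ((A * x + y) * P′ + x * Q′)) ∎)
    where
    open ≡-Reasoning
    s = sgn n
    A = + a n
    P′ = P (suc n)
    Q′ = Q (suc n)
    expand₁ : ∀ s x y p q p′ d →
      s * (x * p + y * q) * - p′ + d * (- (s * x) * 1ℤ) ≡ - s * (x * (p * p′ + d) + y * q * p′)
    expand₁ = solve-∀
    collect₁ : ∀ s x y a q p′ q′ d → - s * (x * (q * (a * p′ + q′)) + y * q * p′)
      ≡ q * (- s * ((a * x + y) * p′ + x * q′)) + d * (0ℤ * - (- s * (a * x + y)))
    collect₁ = solve-∀
    expand₂ : ∀ s x y p q p′ → s * (x * p + y * q) * 1ℤ + - (s * x) * - p′ ≡ s * (x * (p + p′) + y * q)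
    expand₂ = solve-∀
    collect₂ : ∀ s x y a q p′ q′ → s * (x * (a * q) + y * q)
      ≡ q * - (- s * (a * x + y)) + 0ℤ * (- s * ((a * x + y) * p′ + x * q′))
    collect₂ = solve-∀

  TotPosAt-step : ∀ n z → TotPosAt n z ⇔ TotPosAt (suc n) (cf-step n z)
  TotPosAt-step n z =
    Pos-transfer _ _ (Stepₙ.-√D<P′ n) (Reduced.0<Q (reduced n)) (level-step n z) ×-⇔
    Pos-transfer _ _ (Stepₙ.P′<√D n) (Reduced.0<Q (reduced n)) (level-conj-step n z)

  coords : ℕ → OK → ℤ × ℤ
  coords zero (α , β) = (β , α)
  coords (suc n) γ = cf-step n (coords n γ)

  TotPos⇔TotPosAt₀ : ∀ {P₀ Q₀} → InitialPQ D P₀ Q₀ → ∀ α β →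
    TotPos D (α , β) ⇔ (Pos (β * P₀ + α * Q₀ , β) × Pos (1ℤ * (β * P₀ + α * Q₀) , - (1ℤ * β)))
  TotPos⇔TotPosAt₀ h α β with D % 4 ℕₚ.≟ 1
  TotPos⇔TotPosAt₀ (refl , refl) α β | yes _ =
    PosSurd⇔Pos (shuffle α β) refl ×-⇔
    PosSurd⇔Pos (trans (shuffle α β) (sym (*-identityˡ _))) (cong -_ (sym (*-identityˡ β)))
    where
    shuffle : ∀ α β → + 2 * α + β ≡ β * + 1 + α * + 2
    shuffle = solve-∀
  TotPos⇔TotPosAt₀ (refl , refl) α β | no _ =
    PosSurd⇔Pos (shuffle α β) refl ×-⇔
    PosSurd⇔Pos (trans (shuffle α β) (sym (*-identityˡ _))) (cong -_ (sym (*-identityˡ β)))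
    where
    shuffle : ∀ α β → α ≡ β * 0ℤ + α * 1ℤ
    shuffle = solve-∀

  TotPos⇔TotPosAt : ∀ n γ → TotPos D γ ⇔ TotPosAt n (coords n γ)
  TotPos⇔TotPosAt zero (α , β) = TotPos⇔TotPosAt₀ init α β
  TotPos⇔TotPosAt (suc n) γ = TotPosAt-step n (coords n γ) ⇔-∘ TotPos⇔TotPosAt n γ

  cf-step⁻¹ : ℕ → ℤ × ℤ → ℤ × ℤ
  cf-step⁻¹ n (x , y) = (y , x - + a n * y)

  uncoords : ℕ → ℤ × ℤ → OK
  uncoords zero (x , y) = (y , x)
  uncoords (suc n) z = uncoords n (cf-step⁻¹ n z)

  uncoords-coords : ∀ n γ → uncoords n (coords n γ) ≡ γ
  uncoords-coords zero (α , β) = refl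
  uncoords-coords (suc n) γ = trans (cong (uncoords n) (cf-step⁻¹-cf-step (coords n γ))) (uncoords-coords n γ)
    where
    cf-step⁻¹-cf-step : ∀ z → cf-step⁻¹ n (cf-step n z) ≡ z
    cf-step⁻¹-cf-step (x , y) = cong (x ,_) (cancel (+ a n) x y)
      where
      cancel : ∀ a x y → a * x + y - a * x ≡ y
      cancel = solve-∀

  coords-uncoords : ∀ n z → coords n (uncoords n z) ≡ z
  coords-uncoords zero (x , y) = refl
  coords-uncoords (suc n) z = trans (cong (cf-step n) (coords-uncoords n (cf-step⁻¹ n z))) (cf-step-cf-step⁻¹ z)
    where
    cf-step-cf-step⁻¹ : ∀ z → cf-step n (cf-step⁻¹ n z) ≡ z
    cf-step-cf-step⁻¹ (x , y) = cong (_, y) (cancel (+ a n) x y)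
      where
      cancel : ∀ a x y → a * y + (x - a * y) ≡ x
      cancel = solve-∀

  coords-⊕ : ∀ n γ δ → coords n (γ ⊕ δ) ≡ coords n γ ⊕ coords n δ
  coords-⊕ zero (α₁ , β₁) (α₂ , β₂) = refl
  coords-⊕ (suc n) γ δ = trans (cong (cf-step n) (coords-⊕ n γ δ)) (cf-step-⊕ (coords n γ) (coords n δ))
    where
    cf-step-⊕ : ∀ z w → cf-step n (z ⊕ w) ≡ cf-step n z ⊕ cf-step n w
    cf-step-⊕ (x₁ , y₁) (x₂ , y₂) = cong (_, x₁ + x₂) (distrib (+ a n) x₁ y₁ x₂ y₂)
      where
      distrib : ∀ a x₁ y₁ x₂ y₂ → a * (x₁ + x₂) + (y₁ + y₂) ≡ (a * x₁ + y₁) + (a * x₂ + y₂)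
      distrib = solve-∀

  coords-0 : ∀ n → coords n zeroOK ≡ zeroOK
  coords-0 zero = refl
  coords-0 (suc n) = trans (cong (cf-step n) (coords-0 n)) (cong (_, 0ℤ) (trans (+-identityʳ _) (*-zeroʳ (+ a n))))

  TotPosAt-scale : ∀ n {k x y} → 0ℤ < k → TotPosAt n (x , y) → TotPosAt n (k * x , k * y)
  TotPosAt-scale n {k} {x} {y} 0<k (p , p̄) =
    subst Pos (cong₂ _,_ (distrib k x y (P n) (Q n)) refl) (Pos-scale 0<k p) ,
    subst Pos (cong₂ _,_ (distrib-sgn (sgn n) k x y (P n) (Q n)) (distrib-neg (sgn n) k x)) (Pos-scale 0<k p̄)
    where
    distrib : ∀ k x y p q → k * (x * p + y * q) ≡ k * x * p + k * y * q
    distrib = solve-∀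
    distrib-sgn : ∀ s k x y p q → k * (s * (x * p + y * q)) ≡ s * (k * x * p + k * y * q)
    distrib-sgn = solve-∀
    distrib-neg : ∀ s k x → k * - (s * x) ≡ - (s * (k * x))
    distrib-neg = solve-∀

  sgn-odd : ∀ i → Odd i → sgn i ≡ -1ℤ
  sgn-odd zero ()
  sgn-odd (suc zero) _ = refl
  sgn-odd (suc (suc i)) odd = trans (neg-involutive (sgn i)) (sgn-odd i odd)

  module OddLevel {j : ℕ} (odd : Odd (suc j)) where

    private
      i = suc j
      A = + a i
      w : ℤ → ℤ
      w y = 1ℤ * P i + y * Q i
      w-mono : ∀ {y y′} → y ≤ y′ → w y ≤ w y′
      w-mono y≤y′ =
        +-monoʳ-≤ (1ℤ * P i) (*-monoʳ-≤-nonNeg (Q i) {{nonNegative (<⇒≤ (Reduced.0<Q (reduced i)))}} y≤y′)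

    TotPosAt⇔ : ∀ x y → TotPosAt i (x , y) ⇔ (Pos (x * P i + y * Q i , x) × Pos (- (x * P i + y * Q i) , x))
    TotPosAt⇔ x y rewrite sgn-odd i odd =
      mk⇔ (λ (p , p̄) → p , subst Pos conj≡ p̄) (λ (p , p̄) → p , subst Pos (sym conj≡) p̄)
      where
      conj≡ : (-1ℤ * (x * P i + y * Q i) , - (-1ℤ * x)) ≡ (- (x * P i + y * Q i) , x)
      conj≡ = cong₂ _,_ (-1*i≡-i _) (trans (cong -_ (-1*i≡-i x)) (neg-involutive x))

    TotPosAt⇒0<x : ∀ z → TotPosAt i z → 0ℤ < proj₁ z
    TotPosAt⇒0<x (x , y) t = let (p , p̄) = Equivalence.to (TotPosAt⇔ x y) t in proj₁ (Pos-± p p̄)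

    TotPosAt-1⇔ : ∀ y → TotPosAt i (1ℤ , y) ⇔ (- A ≤ y × y ≤ 0ℤ)
    TotPosAt-1⇔ y =
      mk⇔ (bounds ∘ Equivalence.to (TotPosAt⇔ 1ℤ y)) (Equivalence.from (TotPosAt⇔ 1ℤ y) ∘ from-bounds)
      where
      bounds : Pos (w y , 1ℤ) × Pos (- w y , 1ℤ) → - A ≤ y × y ≤ 0ℤ
      bounds (p , p̄) = lower , upper
        where
        lower : - A ≤ y
        lower with - A ≤? y
        ... | yes -A≤y = -A≤y
        ... | no -A≰y = ⊥-elim (Pos-negate-asym _ (Stepₙ.√D<P′+Q i)
                (Pos-monoˡ (≤-trans (w-mono (i<j⇒i≤pred[j] (≰⇒> -A≰y))) (≤-reflexive w[pred-A]≡)) p))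
          where
          w[pred-A]≡ : w (-1ℤ + - A) ≡ - (P (suc i) + Q i)
          w[pred-A]≡ = trans (regroup A (P i) (Q i)) (cong (λ t → - (t + Q i)) (sym (P-rec i)))
            where
            regroup : ∀ a p q → 1ℤ * p + (-1ℤ + - a) * q ≡ - ((a * q - p) + q)
            regroup = solve-∀
        upper : y ≤ 0ℤ
        upper with y ≤? 0ℤ
        ... | yes y≤0 = y≤0
        ... | no y≰0 = ⊥-elim (Pos-negate-asym _ (Stepₙ.√D<Q′+P′ j)
                (Pos-monoˡ (≤-trans (neg-mono-≤ (w-mono (i<j⇒suc[i]≤j (≰⇒> y≰0)))) (≤-reflexive (cong -_ w1≡))) p̄))
          where
          w1≡ : w 1ℤ ≡ Q i + P i
          w1≡ = regroup (P i) (Q i)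
            where
            regroup : ∀ p q → 1ℤ * p + 1ℤ * q ≡ q + p
            regroup = solve-∀
      from-bounds : - A ≤ y × y ≤ 0ℤ → Pos (w y , 1ℤ) × Pos (- w y , 1ℤ)
      from-bounds (-A≤y , y≤0) =
        Pos-monoˡ (≤-trans (≤-reflexive -P′≡) (w-mono -A≤y)) (Stepₙ.P′<√D i) ,
        Pos-monoˡ (≤-trans (≤-reflexive -P≡) (neg-mono-≤ (w-mono y≤0))) (Reduced.P<√D (reduced i))
        where
        -P′≡ : - P (suc i) ≡ w (- A)
        -P′≡ = trans (cong -_ (P-rec i)) (regroup A (P i) (Q i))
          where
          regroup : ∀ a p q → - (a * q - p) ≡ 1ℤ * p + - a * q
          regroup = solve-∀
        -P≡ : - P i ≡ - w 0ℤ
        -P≡ = cong -_ (regroup (P i) (Q i))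
          where
          regroup : ∀ p q → p ≡ 1ℤ * p + 0ℤ * q
          regroup = solve-∀

    TotPos-uncoords⇔ : ∀ z → TotPos D (uncoords i z) ⇔ TotPosAt i z
    TotPos-uncoords⇔ z = subst (λ w → TotPos D (uncoords i z) ⇔ TotPosAt i w) (coords-uncoords i z)
                           (TotPos⇔TotPosAt i (uncoords i z))

    module Partitions = Counting D (a i) (coords i) (uncoords i)
      (uncoords-coords i) (coords-uncoords i) (coords-⊕ i) (coords-0 i)
      (λ {γ} pγ → TotPosAt⇒0<x (coords i γ) (Equivalence.to (TotPos⇔TotPosAt i γ) pγ))
      (λ y → TotPosAt-1⇔ y ⇔-∘ TotPos-uncoords⇔ (1ℤ , y))
      (λ {x} {y} p → Equivalence.from (TotPos-uncoords⇔ _)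
                       (TotPosAt-scale i {+ 2} {x} {y} (+<+ (s≤s z≤n)) (Equivalence.to (TotPos-uncoords⇔ (x , y)) p)))

theorem5p1 : (D : ℕ) → 2 ℕ.≤ D → Squarefree D →
    (a : ℕ → ℕ) → IsCFOmega D a →
    (B : ℕ) → IsMaxOdd a B →
    (m : ℕ) → 1 ℕ.≤ m → m ℕ.≤ B / 2 ℕ.+ 2 →
    Σ OK (λ α → TotPos D α × HasNumPartitions D α m)
theorem5p1 D D≥2 sf a (P , Q , init , floor , P-rec , Q-rec) B ((zero , () , _) , _)
-- The maximality of B is not used: every odd index i gives the range up to ⌊uᵢ/2⌋ + 2.
theorem5p1 D D≥2 sf a (P , Q , init , floor , P-rec , Q-rec) B ((suc j , odd , aᵢ≡B) , _) =
  subst (λ A → ∀ m → 1 ℕ.≤ m → m ℕ.≤ A / 2 ℕ.+ 2 → Σ OK (λ α → TotPos D α × HasNumPartitions D α m))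
    aᵢ≡B Partitions.partition-counts
  where
  open ContinuedFraction D D≥2 sf a P Q init floor P-rec Q-rec
  open OddLevel {j} odd
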